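{- Let $\Pi$ be a partition of $[n]$ with no blocks of size $1$. Let $a,b,c,d\in[n]$ with $a<b$ and $c<d$, and assume that the intervals $\{a,\dots,b\}$ and $\{c,\dots,d\}$ are both unions of interwoven $\Pi$-blocks. If $\{a,\dots,b\}\cap\{c,\dots,d\}\neq\emptyset$, then $\{a,\dots,b\}=\{c,\dots,d\}$.
   Context: $[n]=\{1,\dots,n\}$. For a partition $\Pi$ of $[n]$, an interval $\{a,\dots,b\}\subseteq[n]$ is a union of interwoven $\Pi$-blocks if there are integers $k>1$, $\ell\ge1$ with $b-a+1=k\ell$ such that each set $\{a+i+mk: 0\le m<\ell\}$, $0\le i<k$, is a block of $\Pi$. -}

module Defs where

open import Data.Nat using (ℕ; _+_; _*_; _≤_; _<_; _>_)
open import Data.Product using (Σ; ∃; _×_; _,_)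
open import Relation.Binary.PropositionalEquality using (_≡_; _≢_)
open import Relation.Unary using (Pred)
open import Function.Bundles using (_⇔_)
open import Level using (0ℓ)

InRange : ℕ → ℕ → Set
InRange n x = 1 ≤ x × x ≤ n

-- A partition of [n], given by a block labelling: x,y ∈ [n] lie in the
-- same block iff label x ≡ label y.  Values of label outside [n] are
-- irrelevant.
record Partition (n : ℕ) : Set where
  field
    label : ℕ → ℕ
open Partition public

IsBlock : ∀ {n} → Partition n → Pred ℕ 0ℓ → Set
IsBlock {n} Π S =
  (∀ y → S y → InRange n y) ×
  (∃ λ x → S x) ×
  (∀ x y → S x → InRange n y → (S y ⇔ label Π x ≡ label Π y))

NoSingletons : ∀ {n} → Partition n → Set
NoSingletons {n} Π =
  ∀ x → InRange n x → ∃ λ y → InRange n y × y ≢ x × label Π y ≡ label Π x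

Progression : ℕ → ℕ → ℕ → ℕ → Pred ℕ 0ℓ
Progression a i k ℓ y = ∃ λ m → m < ℓ × y ≡ a + i + m * k

InterwovenUnion : ∀ {n} → Partition n → ℕ → ℕ → Set
InterwovenUnion Π a b =
  Σ ℕ λ k → Σ ℕ λ ℓ →
    k > 1 × 1 ≤ ℓ × b + 1 ≡ a + k * ℓ ×
    (∀ i → i < k → IsBlock Π (Progression a i k ℓ))

-- Blocks through a common point coincide, and a progression with at least two
-- terms (every block has two elements) is determined by its set of terms: first
-- term, step and length.  If a < c ≤ b, the block J₀ of {c,…,d} through c is a
-- block Bᵢ of {a,…,b}, so c = a + i and both unions have the same step k.  For
-- i > 0 the point a + (i − 1) + k = c + (k − 1) would put B_{i−1} and J_{k−1}
-- together, yet B_{i−1} starts before c and J_{k−1} does not.  Hence a = c, and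
-- then B₀ = J₀ forces equal steps and lengths, hence b = d.
module Submission where

open import Defs
open import Data.Nat using (ℕ; zero; suc; _+_; _*_; _∸_; _≤_; _<_; z≤n; s≤s; z<s; >-nonZero)
open import Data.Nat.Properties
open import Data.Nat.DivMod using (_%_; _/_; m≡m%n+[m/n]*n; m%n<n)
open import Data.Product using (∃; _×_; _,_; proj₁; proj₂)
open import Data.Sum using (inj₁; inj₂)
open import Data.Empty using (⊥; ⊥-elim)
open import Function.Bundles using (Equivalence)
open import Relation.Binary.PropositionalEquality
open import Relation.Unary using (Pred; _⊆_; _≐_)
open import Level using (0ℓ)

open Equivalence using (to; from)

private
  variable
    n a b c d i i′ k k′ ℓ ℓ′ y : ℕ
    Π : Partition n
    S T : Pred ℕ 0ℓ

IsBlock-⊆ : IsBlock Π S → IsBlock Π T → ∀ {x} → S x → T x → S ⊆ T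
IsBlock-⊆ (S⊆[n] , _ , S-iff) (_ , _ , T-iff) {x} Sx Tx {y} Sy =
  from (T-iff x y Tx (S⊆[n] y Sy)) (to (S-iff x y Sx (S⊆[n] y Sy)) Sy)

IsBlock-≐ : IsBlock Π S → IsBlock Π T → ∀ {x} → S x → T x → S ≐ T
IsBlock-≐ BS BT Sx Tx = IsBlock-⊆ BS BT Sx Tx , IsBlock-⊆ BT BS Tx Sx

IsBlock-nonsingleton : NoSingletons Π → IsBlock Π S →
                       ∀ {x} → S x → ∃ λ y → S y × y ≢ x
IsBlock-nonsingleton noSingletons (S⊆[n] , _ , S-iff) {x} Sx
  with noSingletons x (S⊆[n] x Sx)
... | y , y∈[n] , y≢x , same = y , from (S-iff x y Sx y∈[n]) (sym same) , y≢x

progression-head : ∀ a i → 0 < ℓ → Progression a i k ℓ (a + i)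
progression-head a i 0<ℓ = 0 , 0<ℓ , sym (+-identityʳ (a + i))

progression-second : ∀ a i → 1 < ℓ → Progression a i k ℓ (a + i + k)
progression-second {k = k} a i 1<ℓ = 1 , 1<ℓ , cong (a + i +_) (sym (*-identityˡ k))

progression-head-≤ : ∀ a i → Progression a i k ℓ y → a + i ≤ y
progression-head-≤ a i (m , _ , refl) = m≤m+n (a + i) _

progression-gap : ∀ a i → Progression a i k ℓ y → a + i < y → a + i + k ≤ y
progression-gap a i (zero , _ , refl) s<y =
  ⊥-elim (<-irrefl (sym (+-identityʳ (a + i))) s<y)
progression-gap {k = k} a i (suc m , _ , refl) _ = +-monoʳ-≤ (a + i) (m≤m+n k (m * k))

progression-cover : 0 < k → a ≤ y → y < a + k * ℓ →
                    ∃ λ i → i < k × Progression a i k ℓ y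
progression-cover {k} {a} {y} {ℓ} 0<k a≤y y<end =
  t % k , m%n<n t k , t / k , t/k<ℓ , y≡
  where
    instance _ = >-nonZero 0<k
    t = y ∸ a
    a+t≡y : a + t ≡ y
    a+t≡y = m+[n∸m]≡n a≤y
    t≡ : t ≡ t % k + t / k * k
    t≡ = m≡m%n+[m/n]*n t k
    y≡ : y ≡ a + t % k + t / k * k
    y≡ = trans (sym a+t≡y) (trans (cong (a +_) t≡) (sym (+-assoc a _ _)))
    t<ℓk : t < ℓ * k
    t<ℓk = +-cancelˡ-< a t (ℓ * k)
             (subst₂ _<_ (sym a+t≡y) (cong (a +_) (*-comm k ℓ)) y<end)
    t/k<ℓ : t / k < ℓ
    t/k<ℓ = *-cancelʳ-< k (t / k) ℓ
              (≤-<-trans (m≤n+m (t / k * k) (t % k)) (subst (_< ℓ * k) t≡ t<ℓk))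

progression-⊆-length : ∀ a i → 0 < k →
  Progression a i k ℓ ⊆ Progression a i k ℓ′ → ℓ ≤ ℓ′
progression-⊆-length {ℓ = zero} _ _ _ _ = z≤n
progression-⊆-length {k = k} {ℓ = suc ℓ₀} {ℓ′ = ℓ′} a i 0<k P⊆Q
  with P⊆Q (ℓ₀ , ≤-refl , refl)
... | m , m<ℓ′ , e = subst (λ j → suc j ≤ ℓ′) (sym ℓ₀≡m) m<ℓ′
  where
    instance _ = >-nonZero 0<k
    ℓ₀≡m : ℓ₀ ≡ m
    ℓ₀≡m = *-cancelʳ-≡ ℓ₀ m k (+-cancelˡ-≡ (a + i) _ _ e)

progression-≐-head : ∀ a i c i′ → 0 < ℓ → 0 < ℓ′ →
  Progression a i k ℓ ≐ Progression c i′ k′ ℓ′ → a + i ≡ c + i′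
progression-≐-head a i c i′ 0<ℓ 0<ℓ′ (P⊆Q , Q⊆P) =
  ≤-antisym (progression-head-≤ a i (Q⊆P (progression-head c i′ 0<ℓ′)))
            (progression-head-≤ c i′ (P⊆Q (progression-head a i 0<ℓ)))

progression-⊆-step : ∀ a i c i′ → 0 < k → 1 < ℓ → a + i ≡ c + i′ →
  Progression a i k ℓ ⊆ Progression c i′ k′ ℓ′ → k′ ≤ k
progression-⊆-step {k = k} {k′ = k′} a i c i′ 0<k 1<ℓ heads P⊆Q =
  +-cancelˡ-≤ (a + i) k′ k (subst (λ s → s + k′ ≤ a + i + k) (sym heads)
    (progression-gap c i′ (P⊆Q (progression-second a i 1<ℓ))
                     (subst (_< a + i + k) heads (m<m+n (a + i) 0<k))))

progression-≐-step : ∀ a i c i′ → 0 < k → 0 < k′ → 1 < ℓ → 1 < ℓ′ →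
  Progression a i k ℓ ≐ Progression c i′ k′ ℓ′ → k ≡ k′
progression-≐-step a i c i′ 0<k 0<k′ 1<ℓ 1<ℓ′ P≐Q =
  ≤-antisym (progression-⊆-step c i′ a i 0<k′ 1<ℓ′ (sym heads) (proj₂ P≐Q))
            (progression-⊆-step a i c i′ 0<k 1<ℓ heads (proj₁ P≐Q))
  where
    heads : a + i ≡ c + i′
    heads = progression-≐-head a i c i′ (<-trans z<s 1<ℓ) (<-trans z<s 1<ℓ′) P≐Q

progression-block-length : ∀ a i → NoSingletons Π →
  IsBlock Π (Progression a i k ℓ) → 1 < ℓ
progression-block-length a i noSingletons B@(_ , (_ , (m , m<ℓ , _)) , _)
  with IsBlock-nonsingleton noSingletons B (progression-head a i (m<n⇒0<n m<ℓ))
... | _ , (zero , _ , refl) , y≢head = ⊥-elim (y≢head (+-identityʳ (a + i)))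
... | _ , (suc m′ , m′<ℓ , _) , _ = ≤-trans (s≤s (s≤s z≤n)) m′<ℓ

¬interwoven-shift : NoSingletons Π →
  (∀ j → j < k → IsBlock Π (Progression a j k ℓ)) →
  (∀ j → j < k → IsBlock Π (Progression c j k ℓ′)) →
  suc i < k → c ≡ a + suc i → ⊥
¬interwoven-shift {Π = Π} {k = suc k₀} {a = a} {ℓ = ℓ} {c = c} {ℓ′ = ℓ′} {i = i}
  noSingletons B J 1+i<k c≡ =
  <-irrefl refl (≤-trans c≤c+k₀ (≤-reflexive (sym heads)))
  where
    Bᵢ : IsBlock Π (Progression a i (suc k₀) ℓ)
    Bᵢ = B i (<-trans (n<1+n i) 1+i<k)
    Jₖ₀ : IsBlock Π (Progression c k₀ (suc k₀) ℓ′)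
    Jₖ₀ = J k₀ ≤-refl
    lengthB : 1 < ℓ
    lengthB = progression-block-length a i noSingletons Bᵢ
    lengthJ : 1 < ℓ′
    lengthJ = progression-block-length c k₀ noSingletons Jₖ₀
    meeting-point : a + i + suc k₀ ≡ c + k₀
    meeting-point = begin
      a + i + suc k₀     ≡⟨ +-suc (a + i) k₀ ⟩
      suc (a + i) + k₀   ≡⟨ cong (_+ k₀) (trans (sym (+-suc a i)) (sym c≡)) ⟩
      c + k₀             ∎
      where open ≡-Reasoning
    heads : a + i ≡ c + k₀
    heads = progression-≐-head a i c k₀ (<-trans z<s lengthB) (<-trans z<s lengthJ)
              (IsBlock-≐ Bᵢ Jₖ₀ (progression-second a i lengthB)
                (subst (Progression c k₀ (suc k₀) ℓ′) (sym meeting-point)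
                  (progression-head c k₀ (<-trans z<s lengthJ))))
    c≤c+k₀ : suc (a + i) ≤ c + k₀
    c≤c+k₀ = subst (_≤ c + k₀) (trans c≡ (+-suc a i)) (m≤m+n c k₀)

interwoven-start : NoSingletons Π → InterwovenUnion Π a b → InterwovenUnion Π c d →
                   a ≤ c → c ≤ b → a ≡ c
interwoven-start {Π = Π} {a} {b} {c} noSingletons
  (k , ℓ , 1<k , _ , b+1≡ , B) (k′ , ℓ′ , 1<k′ , 0<ℓ′ , _ , J) a≤c c≤b
  with progression-cover (<-trans z<s 1<k) a≤c
         (subst (c <_) (trans (+-comm 1 b) b+1≡) (s≤s c≤b))
... | i , i<k , c∈Bᵢ = start-offset i i<k c≡a+i
  where
    J₀ : IsBlock Π (Progression c 0 k′ ℓ′)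
    J₀ = J 0 (<-trans z<s 1<k′)
    lengthB : 1 < ℓ
    lengthB = progression-block-length a i noSingletons (B i i<k)
    lengthJ : 1 < ℓ′
    lengthJ = progression-block-length c 0 noSingletons J₀
    Bᵢ≐J₀ : Progression a i k ℓ ≐ Progression c 0 k′ ℓ′
    Bᵢ≐J₀ = IsBlock-≐ (B i i<k) J₀ c∈Bᵢ
              (subst (Progression c 0 k′ ℓ′) (+-identityʳ c) (progression-head c 0 0<ℓ′))
    c≡a+i : c ≡ a + i
    c≡a+i = trans (sym (+-identityʳ c))
              (sym (progression-≐-head a i c 0 (<-trans z<s lengthB) 0<ℓ′ Bᵢ≐J₀))
    J′ : ∀ j → j < k → IsBlock Π (Progression c j k ℓ′)
    J′ = subst (λ s → ∀ j → j < s → IsBlock Π (Progression c j s ℓ′))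
               (sym (progression-≐-step a i c 0 (<-trans z<s 1<k) (<-trans z<s 1<k′)
                                         lengthB lengthJ Bᵢ≐J₀))
               J
    start-offset : ∀ j → j < k → c ≡ a + j → a ≡ c
    start-offset zero    _   c≡a+0 = trans (sym (+-identityʳ a)) (sym c≡a+0)
    start-offset (suc j) j<k c≡a+j = ⊥-elim (¬interwoven-shift noSingletons B J′ j<k c≡a+j)

interwoven-end : NoSingletons Π → InterwovenUnion Π a b → InterwovenUnion Π a d → b ≡ d
interwoven-end {Π = Π} {a = a} {b = b} {d = d} noSingletons
  (k , ℓ , 1<k , 0<ℓ , b+1≡ , B) (k′ , ℓ′ , 1<k′ , 0<ℓ′ , d+1≡ , J) =
  +-cancelʳ-≡ 1 b d (begin
    b + 1        ≡⟨ b+1≡ ⟩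
    a + k * ℓ    ≡⟨ cong₂ (λ s m → a + s * m) k≡k′ ℓ≡ℓ′ ⟩
    a + k′ * ℓ′  ≡⟨ sym d+1≡ ⟩
    d + 1        ∎)
  where
    open ≡-Reasoning
    0<k : 0 < k
    0<k = <-trans z<s 1<k
    B₀ : IsBlock Π (Progression a 0 k ℓ)
    B₀ = B 0 0<k
    J₀ : IsBlock Π (Progression a 0 k′ ℓ′)
    J₀ = J 0 (<-trans z<s 1<k′)
    B₀≐J₀ : Progression a 0 k ℓ ≐ Progression a 0 k′ ℓ′
    B₀≐J₀ = IsBlock-≐ B₀ J₀ (progression-head a 0 0<ℓ) (progression-head a 0 0<ℓ′)
    k≡k′ : k ≡ k′
    k≡k′ = progression-≐-step a 0 a 0 0<k (<-trans z<s 1<k′)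
             (progression-block-length a 0 noSingletons B₀)
             (progression-block-length a 0 noSingletons J₀) B₀≐J₀
    B₀≐J₀′ : Progression a 0 k ℓ ≐ Progression a 0 k ℓ′
    B₀≐J₀′ = subst (λ s → Progression a 0 k ℓ ≐ Progression a 0 s ℓ′) (sym k≡k′) B₀≐J₀
    ℓ≡ℓ′ : ℓ ≡ ℓ′
    ℓ≡ℓ′ = ≤-antisym (progression-⊆-length a 0 0<k (proj₁ B₀≐J₀′))
                     (progression-⊆-length a 0 0<k (proj₂ B₀≐J₀′))

lemma9p1 : (n : ℕ) (Π : Partition n) → NoSingletons Π →
    (a b c d : ℕ) → InRange n a → InRange n b → InRange n c → InRange n d →
    a < b → c < d →
    InterwovenUnion Π a b → InterwovenUnion Π c d →
    (∃ λ x → (a ≤ x × x ≤ b) × (c ≤ x × x ≤ d)) →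
    a ≡ c × b ≡ d
lemma9p1 n Π noSingletons a b c d _ _ _ _ _ _ U V (x , (a≤x , x≤b) , (c≤x , x≤d)) =
  a≡c , interwoven-end noSingletons U (subst (λ s → InterwovenUnion Π s d) (sym a≡c) V)
  where
    a≡c : a ≡ c
    a≡c with ≤-total a c
    ... | inj₁ a≤c = interwoven-start noSingletons U V a≤c (≤-trans c≤x x≤b)
    ... | inj₂ c≤a = sym (interwoven-start noSingletons V U c≤a (≤-trans a≤x x≤d))
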